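{- Let $G=(V,E)$ be an undirected graph and let $M$ be a maximal triangle-free 2-matching of $G$, i.e. a triangle-free 2-matching such that for every edge $e\in E\setminus M$, $M\cup\{e\}$ is not a triangle-free 2-matching. Then $|M|\geq |M^*|/2$, where $M^*$ is a maximum-cardinality triangle-free 2-matching of $G$.
   Context: A 2-matching of $G=(V,E)$ is a set $M\subseteq E$ such that each node is incident to at most two edges of $M$; it is triangle-free if the graph $(V,M)$ contains no triangle. -}

module Defs where

open import Data.Nat using (ℕ; _≤_)
open import Data.Fin using (Fin; _<_; _≟_)
open import Data.Product using (_×_; _,_; proj₁; proj₂; ∃)
open import Data.Sum using (_⊎_)
open import Data.List using (List; length; filter; _∷_)
open import Data.List.Membership.Propositional using (_∈_; _∉_)
open import Data.List.Relation.Unary.All using (All)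
open import Data.List.Relation.Unary.Unique.Propositional using (Unique)
open import Relation.Nullary using (¬_)
open import Relation.Nullary.Decidable using (_⊎-dec_)
open import Relation.Binary.PropositionalEquality using (_≡_)

-- An edge of a graph on vertex set Fin n is stored as an ordered pair (u , v)
-- with u < v, representing the unordered pair {u , v}.
Edge : ℕ → Set
Edge n = Fin n × Fin n

record Graph (n : ℕ) : Set where
  field
    E          : List (Edge n)
    normalised : All (λ e → proj₁ e < proj₂ e) E
    unique     : Unique E
open Graph public

EdgeSet : ℕ → Set
EdgeSet n = List (Edge n)

Incident : ∀ {n} → Edge n → Fin n → Set
Incident (a , b) v = (a ≡ v) ⊎ (b ≡ v)

deg : ∀ {n} → EdgeSet n → Fin n → ℕ
deg M v = length (filter (λ e → (proj₁ e ≟ v) ⊎-dec (proj₂ e ≟ v)) M)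

Adj : ∀ {n} → EdgeSet n → Fin n → Fin n → Set
Adj M u v = ((u , v) ∈ M) ⊎ ((v , u) ∈ M)

HasTriangle : ∀ {n} → EdgeSet n → Set
HasTriangle {n} M =
  ∃ λ (a : Fin n) → ∃ λ (b : Fin n) → ∃ λ (c : Fin n) →
     (¬ a ≡ b) × (¬ b ≡ c) × (¬ a ≡ c) × Adj M a b × Adj M b c × Adj M a c

Is2Matching : ∀ {n} → Graph n → EdgeSet n → Set
Is2Matching G M =
  Unique M × All (λ e → e ∈ E G) M × (∀ v → deg M v ≤ 2)

IsTF2Matching : ∀ {n} → Graph n → EdgeSet n → Set
IsTF2Matching G M = Is2Matching G M × ¬ HasTriangle M

IsMaximalTF2Matching : ∀ {n} → Graph n → EdgeSet n → Set
IsMaximalTF2Matching G M =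
  IsTF2Matching G M ×
  (∀ e → e ∈ E G → e ∉ M → ¬ IsTF2Matching G (e ∷ M))

IsMaximumTF2Matching : ∀ {n} → Graph n → EdgeSet n → Set
IsMaximumTF2Matching G M =
  IsTF2Matching G M × (∀ N → IsTF2Matching G N → length N ≤ length M)

{-# OPTIONS --safe #-}
module Submission where

-- Every edge ab of G satisfies deg_M a + deg_M b ≥ 2: otherwise one endpoint
-- is untouched by M and the other has M-degree at most 1, so ab could be added
-- to M (a triangle through ab would need M-edges at both of its endpoints).
-- Summing over M* and counting the pairs (edge of M*, edge of M) that share an
-- endpoint in both orders,
--   2|M*| ≤ Σ_{ab ∈ M*} (deg_M a + deg_M b) = Σ_v deg_M v · deg_M* v
--        = Σ_{ab ∈ M} (deg_M* a + deg_M* b) ≤ 4|M|,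
-- the last step because M* is a 2-matching.

open import Defs
open import Data.Nat using (ℕ; zero; suc; _+_; _*_; _≤_; _≤?_; z≤n; s≤s; s≤s⁻¹)
open import Data.Nat.Properties
  using ( +-*-semiring; +-identityʳ; +-mono-≤; *-comm; *-assoc; *-zeroʳ; *-identityʳ
        ; *-distribˡ-+; ≤-reflexive; *-cancelʳ-≤; ≰⇒>; n>0⇒n≢0; n≤0⇒n≡0
        ; m+n≤o⇒m≤o; m+n≤o⇒n≤o; module ≤-Reasoning)
open import Data.Fin using (Fin; _≟_; punchIn)
open import Data.Fin.Properties using (punchInᵢ≢i; <⇒≢)
open import Data.Product using (_×_; _,_; proj₁; proj₂)
open import Data.Product.Properties using (≡-dec)
open import Data.Sum using (_⊎_; inj₁; inj₂; swap)
open import Data.Bool using (if_then_else_)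
open import Data.Empty using (⊥-elim)
open import Data.List using ([]; _∷_; length)
open import Data.List.Properties using (filter-accept; filter-reject)
open import Data.List.Membership.Propositional using (_∈_; _∉_)
open import Data.List.Membership.Propositional.Properties using (∈-filter⁺; ∈-length)
import Data.List.Membership.DecPropositional as DecMembership
open import Data.List.Relation.Unary.Any using (here; there)
open import Data.List.Relation.Unary.All as All using (All; []; _∷_)
open import Data.List.Relation.Unary.All.Properties using (¬Any⇒All¬)
open import Data.List.Relation.Unary.AllPairs using (_∷_)
open import Function using (_∘_)
open import Relation.Nullary using (¬_; Dec; yes; no; does)
open import Relation.Nullary.Decidable using (_⊎-dec_)
open import Relation.Binary.PropositionalEquality
  using (_≡_; _≢_; refl; sym; trans; cong; cong₂; subst)
open import Algebra.Properties.Semiring.Sum +-*-semiring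
  using (sum; sum-syntax; sum-cong-≗; sum-remove; sum-replicate-zero; ∑-distrib-+)

private
  variable
    n : ℕ

∑-supported-at : (g : Fin n → ℕ) (a : Fin n) → (∀ v → v ≢ a → g v ≡ 0) → sum g ≡ g a
∑-supported-at {suc n} g a g≡0 = begin
  sum g                              ≡⟨ sum-remove {i = a} g ⟩
  g a + ∑[ j < n ] g (punchIn a j)   ≡⟨ cong (g a +_) (sum-cong-≗ (g≡0 _ ∘ punchInᵢ≢i a)) ⟩
  g a + ∑[ j < n ] 0                 ≡⟨ cong (g a +_) (sum-replicate-zero n) ⟩
  g a + 0                            ≡⟨ +-identityʳ (g a) ⟩
  g a                                ∎
  where open Relation.Binary.PropositionalEquality.≡-Reasoning

δ : Fin n → Fin n → ℕ
δ a v = if does (a ≟ v) then 1 else 0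

∑-*-δ : (f : Fin n → ℕ) (a : Fin n) → ∑[ v < n ] (f v * δ a v) ≡ f a
∑-*-δ f a = trans (∑-supported-at _ a off-a) (at-a a)
  where
  off-a : ∀ v → v ≢ a → f v * δ a v ≡ 0
  off-a v v≢a with a ≟ v
  ... | yes refl = ⊥-elim (v≢a refl)
  ... | no _     = *-zeroʳ (f v)
  at-a : ∀ a → f a * δ a a ≡ f a
  at-a a with a ≟ a
  ... | yes _  = *-identityʳ (f a)
  ... | no a≢a = ⊥-elim (a≢a refl)

Incident? : (v : Fin n) (e : Edge n) → Dec (Incident e v)
Incident? v e = (proj₁ e ≟ v) ⊎-dec (proj₂ e ≟ v)

Loopless : Edge n → Set
Loopless e = proj₁ e ≢ proj₂ e

deg-∷-incident : ∀ {e : Edge n} {L v} → Incident e v → deg (e ∷ L) v ≡ suc (deg L v)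
deg-∷-incident {e = e} {L} {v} e∋v = cong length (filter-accept (Incident? v) {e} {L} e∋v)

deg-∷-¬incident : ∀ {e : Edge n} {L v} → ¬ Incident e v → deg (e ∷ L) v ≡ deg L v
deg-∷-¬incident {e = e} {L} {v} e∌v = cong length (filter-reject (Incident? v) {e} {L} e∌v)

deg-∷ : (e : Edge n) (L : EdgeSet n) (v : Fin n) → deg (e ∷ L) v ≡ deg (e ∷ []) v + deg L v
deg-∷ e L v with Incident? v e
... | yes e∋v = trans (deg-∷-incident e∋v) (cong (_+ deg L v) (sym (deg-∷-incident e∋v)))
... | no e∌v  = trans (deg-∷-¬incident e∌v) (cong (_+ deg L v) (sym (deg-∷-¬incident e∌v)))

deg-singleton : ∀ {a b : Fin n} → a ≢ b → ∀ v → deg ((a , b) ∷ []) v ≡ δ a v + δ b v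
deg-singleton {a = a} {b} a≢b v with a ≟ v | b ≟ v
... | yes refl | yes refl = ⊥-elim (a≢b refl)
... | yes _    | no _     = refl
... | no _     | yes _    = refl
... | no _     | no _     = refl

∈⇒1≤deg : ∀ {e : Edge n} {L v} → e ∈ L → Incident e v → 1 ≤ deg L v
∈⇒1≤deg {v = v} e∈L e∋v = ∈-length (∈-filter⁺ (Incident? v) e∈L e∋v)

Adj⇒1≤deg : ∀ {M : EdgeSet n} {p q} → Adj M p q → 1 ≤ deg M p
Adj⇒1≤deg (inj₁ pq∈M) = ∈⇒1≤deg pq∈M (inj₁ refl)
Adj⇒1≤deg (inj₂ qp∈M) = ∈⇒1≤deg qp∈M (inj₂ refl)

∑-*-deg-∷ : (f : Fin n → ℕ) {a b : Fin n} (L : EdgeSet n) → a ≢ b →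
  ∑[ v < n ] (f v * deg ((a , b) ∷ L) v) ≡ f a + f b + ∑[ v < n ] (f v * deg L v)
∑-*-deg-∷ {n} f {a} {b} L a≢b = begin
  ∑[ v < n ] (f v * deg ((a , b) ∷ L) v)
    ≡⟨ sum-cong-≗ (λ v → trans (cong (f v *_) (deg-∷ (a , b) L v))
                               (*-distribˡ-+ (f v) (deg ((a , b) ∷ []) v) (deg L v))) ⟩
  ∑[ v < n ] (f v * deg ((a , b) ∷ []) v + f v * deg L v)
    ≡⟨ ∑-distrib-+ (λ v → f v * deg ((a , b) ∷ []) v) (λ v → f v * deg L v) ⟩
  ∑[ v < n ] (f v * deg ((a , b) ∷ []) v) + ∑[ v < n ] (f v * deg L v)
    ≡⟨ cong (_+ ∑[ v < n ] (f v * deg L v)) ∑-*-deg-singleton ⟩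
  f a + f b + ∑[ v < n ] (f v * deg L v) ∎
  where
  open Relation.Binary.PropositionalEquality.≡-Reasoning
  ∑-*-deg-singleton : ∑[ v < n ] (f v * deg ((a , b) ∷ []) v) ≡ f a + f b
  ∑-*-deg-singleton = begin
    ∑[ v < n ] (f v * deg ((a , b) ∷ []) v)
      ≡⟨ sum-cong-≗ (λ v → trans (cong (f v *_) (deg-singleton a≢b v))
                                 (*-distribˡ-+ (f v) (δ a v) (δ b v))) ⟩
    ∑[ v < n ] (f v * δ a v + f v * δ b v)
      ≡⟨ ∑-distrib-+ (λ v → f v * δ a v) (λ v → f v * δ b v) ⟩
    ∑[ v < n ] (f v * δ a v) + ∑[ v < n ] (f v * δ b v)
      ≡⟨ cong₂ _+_ (∑-*-δ f a) (∑-*-δ f b) ⟩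
    f a + f b ∎

endpointSum : (Fin n → ℕ) → Edge n → ℕ
endpointSum f (a , b) = f a + f b

∑-*-deg-≥ : (f : Fin n → ℕ) {k : ℕ} {L : EdgeSet n} → All Loopless L →
  All ((k ≤_) ∘ endpointSum f) L → length L * k ≤ ∑[ v < n ] (f v * deg L v)
∑-*-deg-≥ f [] [] = z≤n
∑-*-deg-≥ {n} f {k} {(a , b) ∷ L} (a≢b ∷ loopless) (k≤ ∷ k≤s) = begin
  k + length L * k                        ≤⟨ +-mono-≤ k≤ (∑-*-deg-≥ f loopless k≤s) ⟩
  f a + f b + ∑[ v < n ] (f v * deg L v)  ≡⟨ ∑-*-deg-∷ f L a≢b ⟨
  ∑[ v < n ] (f v * deg ((a , b) ∷ L) v)  ∎
  where open ≤-Reasoning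

∑-*-deg-≤ : (f : Fin n → ℕ) {k : ℕ} {L : EdgeSet n} → All Loopless L →
  All ((_≤ k) ∘ endpointSum f) L → ∑[ v < n ] (f v * deg L v) ≤ length L * k
∑-*-deg-≤ {n} f [] [] = ≤-reflexive (trans (sum-cong-≗ (*-zeroʳ ∘ f)) (sum-replicate-zero n))
∑-*-deg-≤ {n} f {k} {(a , b) ∷ L} (a≢b ∷ loopless) (≤k ∷ ≤ks) = begin
  ∑[ v < n ] (f v * deg ((a , b) ∷ L) v)  ≡⟨ ∑-*-deg-∷ f L a≢b ⟩
  f a + f b + ∑[ v < n ] (f v * deg L v)  ≤⟨ +-mono-≤ ≤k (∑-*-deg-≤ f loopless ≤ks) ⟩
  k + length L * k                        ∎
  where open ≤-Reasoning

incident-pair : ∀ {a b x y c : Fin n} → x ≢ y →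
  Incident (a , b) x → Incident (a , b) y → Incident (a , b) c → c ≡ x ⊎ c ≡ y
incident-pair x≢y (inj₁ refl) (inj₁ refl) _           = ⊥-elim (x≢y refl)
incident-pair _   (inj₁ refl) (inj₂ refl) (inj₁ refl) = inj₁ refl
incident-pair _   (inj₁ refl) (inj₂ refl) (inj₂ refl) = inj₂ refl
incident-pair _   (inj₂ refl) (inj₁ refl) (inj₁ refl) = inj₂ refl
incident-pair _   (inj₂ refl) (inj₁ refl) (inj₂ refl) = inj₁ refl
incident-pair x≢y (inj₂ refl) (inj₂ refl) _           = ⊥-elim (x≢y refl)

¬three-incident : ∀ {a b x y z : Fin n} → x ≢ y → x ≢ z → y ≢ z →
  Incident (a , b) x → Incident (a , b) y → ¬ Incident (a , b) z
¬three-incident x≢y x≢z y≢z ab∋x ab∋y ab∋z with incident-pair x≢y ab∋x ab∋y ab∋z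
... | inj₁ refl = x≢z refl
... | inj₂ refl = y≢z refl

1≤deg-incident : ∀ {a b p q c : Fin n} {M} → p ≢ q → Incident (a , b) p → Incident (a , b) q →
  1 ≤ deg M p → 1 ≤ deg M q → Incident (a , b) c → 1 ≤ deg M c
1≤deg-incident p≢q ab∋p ab∋q 1≤p 1≤q ab∋c with incident-pair p≢q ab∋p ab∋q ab∋c
... | inj₁ refl = 1≤p
... | inj₂ refl = 1≤q

Adj-∷ : ∀ {e : Edge n} {M p q} → Adj (e ∷ M) p q → Adj M p q ⊎ (Incident e p × Incident e q)
Adj-∷ (inj₁ (here refl)) = inj₂ (inj₁ refl , inj₂ refl)
Adj-∷ (inj₂ (here refl)) = inj₂ (inj₂ refl , inj₁ refl)
Adj-∷ (inj₁ (there pq))  = inj₁ (inj₁ pq)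
Adj-∷ (inj₂ (there qp))  = inj₁ (inj₂ qp)

∷-triangleFree : ∀ {a b c : Fin n} {M} → Incident (a , b) c → deg M c ≡ 0 →
  ¬ HasTriangle M → ¬ HasTriangle ((a , b) ∷ M)
∷-triangleFree {M = M} ab∋c c-isolated no-triangle
               (x , y , z , x≢y , y≢z , x≢z , xy , yz , xz)
  with Adj-∷ xy | Adj-∷ yz | Adj-∷ xz
... | inj₁ xy′ | inj₁ yz′ | inj₁ xz′ =
  no-triangle (x , y , z , x≢y , y≢z , x≢z , xy′ , yz′ , xz′)
... | inj₂ (ab∋x , ab∋y) | inj₂ (_ , ab∋z) | _ = ¬three-incident x≢y x≢z y≢z ab∋x ab∋y ab∋z
... | inj₂ (ab∋x , ab∋y) | _ | inj₂ (_ , ab∋z) = ¬three-incident x≢y x≢z y≢z ab∋x ab∋y ab∋z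
... | _ | inj₂ (ab∋y , ab∋z) | inj₂ (ab∋x , _) = ¬three-incident x≢y x≢z y≢z ab∋x ab∋y ab∋z
... | inj₂ (ab∋x , ab∋y) | inj₁ yz′ | inj₁ xz′ = n>0⇒n≢0
  (1≤deg-incident {M = M} x≢y ab∋x ab∋y (Adj⇒1≤deg xz′) (Adj⇒1≤deg yz′) ab∋c)
  c-isolated
... | inj₁ xy′ | inj₂ (ab∋y , ab∋z) | inj₁ xz′ = n>0⇒n≢0
  (1≤deg-incident {M = M} y≢z ab∋y ab∋z (Adj⇒1≤deg (swap xy′)) (Adj⇒1≤deg (swap xz′)) ab∋c)
  c-isolated
... | inj₁ xy′ | inj₁ yz′ | inj₂ (ab∋x , ab∋z) = n>0⇒n≢0
  (1≤deg-incident {M = M} x≢z ab∋x ab∋z (Adj⇒1≤deg xy′) (Adj⇒1≤deg (swap yz′)) ab∋c)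
  c-isolated

∷-is2Matching : ∀ {G : Graph n} {M a b} → Is2Matching G M → (a , b) ∈ E G → (a , b) ∉ M →
  deg M a ≤ 1 → deg M b ≤ 1 → Is2Matching G ((a , b) ∷ M)
∷-is2Matching {M = M} {a} {b} (unique , M⊆E , deg≤2) ab∈E ab∉M a≤1 b≤1 =
  (¬Any⇒All¬ M ab∉M ∷ unique) , (ab∈E ∷ M⊆E) , deg-∷≤2
  where
  deg-∷≤2 : ∀ v → deg ((a , b) ∷ M) v ≤ 2
  deg-∷≤2 v with Incident? v (a , b)
  ... | yes ab∋v@(inj₁ refl) = subst (_≤ 2) (sym (deg-∷-incident ab∋v)) (s≤s a≤1)
  ... | yes ab∋v@(inj₂ refl) = subst (_≤ 2) (sym (deg-∷-incident ab∋v)) (s≤s b≤1)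
  ... | no ab∌v              = subst (_≤ 2) (sym (deg-∷-¬incident ab∌v)) (deg≤2 v)

∷-isTF2Matching : ∀ {G : Graph n} {M a b} → IsTF2Matching G M → (a , b) ∈ E G → (a , b) ∉ M →
  deg M a + deg M b ≤ 1 → IsTF2Matching G ((a , b) ∷ M)
∷-isTF2Matching {G = G} {M} {a} {b} (matching , no-triangle) ab∈E ab∉M sum≤1 =
  ∷-is2Matching {G = G} matching ab∈E ab∉M
    (m+n≤o⇒m≤o (deg M a) sum≤1) (m+n≤o⇒n≤o (deg M a) sum≤1) ,
  triangleFree (deg M a) (deg M b) refl refl sum≤1
  where
  triangleFree : ∀ i j → deg M a ≡ i → deg M b ≡ j → i + j ≤ 1 → ¬ HasTriangle ((a , b) ∷ M)
  triangleFree zero    _ a-isolated _          _           =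
    ∷-triangleFree (inj₁ refl) a-isolated no-triangle
  triangleFree (suc i) j _          b-isolated (s≤s i+j≤0) =
    ∷-triangleFree (inj₂ refl) (trans b-isolated (n≤0⇒n≡0 (m+n≤o⇒n≤o i i+j≤0))) no-triangle

maximal⇒2≤endpointSum : ∀ {G : Graph n} {M e} → IsMaximalTF2Matching G M → e ∈ E G →
  2 ≤ endpointSum (deg M) e
maximal⇒2≤endpointSum {n} {G} {M} {a , b} (tf , maximal) ab∈E with (a , b) ∈? M
  where open DecMembership (≡-dec (_≟_ {n}) _≟_) using (_∈?_)
... | yes ab∈M = +-mono-≤ (∈⇒1≤deg ab∈M (inj₁ refl)) (∈⇒1≤deg ab∈M (inj₂ refl))
... | no ab∉M with 2 ≤? deg M a + deg M b
...   | yes 2≤sum = 2≤sum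
...   | no 2≰sum  = ⊥-elim (maximal (a , b) ab∈E ab∉M
                      (∷-isTF2Matching {G = G} tf ab∈E ab∉M (s≤s⁻¹ (≰⇒> 2≰sum))))

edges-loopless : (G : Graph n) {L : EdgeSet n} → All (_∈ E G) L → All Loopless L
edges-loopless G = All.map (<⇒≢ ∘ All.lookup (normalised G))

lemma2 : ∀ {n} (G : Graph n) (M Mstar : EdgeSet n) →
    IsMaximalTF2Matching G M → IsMaximumTF2Matching G Mstar →
    length Mstar ≤ 2 * length M
lemma2 {n} G M Mstar maximal@(((_ , M⊆E , _) , _) , _) (((_ , Mstar⊆E , degMstar≤2) , _) , _) =
  *-cancelʳ-≤ (length Mstar) (2 * length M) 2 (begin
    length Mstar * 2
      ≤⟨ ∑-*-deg-≥ (deg M) (edges-loopless G Mstar⊆E)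
                   (All.map (maximal⇒2≤endpointSum {G = G} maximal) Mstar⊆E) ⟩
    ∑[ v < n ] (deg M v * deg Mstar v)
      ≡⟨ sum-cong-≗ (λ v → *-comm (deg M v) (deg Mstar v)) ⟩
    ∑[ v < n ] (deg Mstar v * deg M v)
      ≤⟨ ∑-*-deg-≤ (deg Mstar) (edges-loopless G M⊆E)
                   (All.universal (λ (a , b) → +-mono-≤ (degMstar≤2 a) (degMstar≤2 b)) M) ⟩
    length M * 4
      ≡⟨ *-assoc (length M) 2 2 ⟨
    length M * 2 * 2
      ≡⟨ cong (_* 2) (*-comm (length M) 2) ⟩
    2 * length M * 2 ∎)
  where open ≤-Reasoning
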